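{- Let $n=2^i(2k+1)$ with integers $i\ge 1$ and $k\ge 0$. (1) If $i=1$, then $(n-1)!!\equiv 2k+1\pmod n$. (2) If $i=2$, then $(n-1)!!\equiv -(2k+1)^2\pmod n$. (3) If $i>2$, then $(n-1)!!\equiv (2k+1)^{2^{i-2}}\pmod n$.
   Context: For a natural number $m$, the double factorial $m!!$ is the product of the natural numbers less than or equal to $m$ that have the same parity as $m$ (so for even $n$, $(n-1)!!$ is the product of all odd numbers $1,3,\dots,n-1$). -}

module Defs where

open import Data.Nat using (ℕ; zero; suc; _*_)
open import Data.Integer using (ℤ; _-_)
open import Data.Integer.Divisibility using (_∣_)

_!! : ℕ → ℕ
zero !! = 1
suc zero !! = 1
suc (suc m) !! = suc (suc m) * (m !!)

_≡_[mod_] : ℤ → ℤ → ℤ → Set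
a ≡ b [mod n ] = n ∣ (a - b)

{-# OPTIONS --safe #-}
module Submission where

-- Write n = 2L with L = 2^(i-1) m and m = 2k + 1, so that (n - 1)!! is the product P(L) of
-- the first L odd numbers. Modulo m both sides vanish (m is a factor of P(L) and divides
-- each right-hand side), so by the Chinese remainder theorem only the congruence modulo 2^i
-- matters. Modulo 4L each shifted factor 2(L + l) + 1 is (2l + 1)(1 + 2L), whence
-- P(M + L) ≡ P(L) P(M) (1 + 2LM). This gives P(A t) ≡ P(A)^t (mod 2A), and for even L
-- P(2L) ≡ P(L)^2 (mod 4L), so P(2^(h+2)) ≡ 1 (mod 2^(h+3)) by repeated squaring (Gauss's
-- generalisation of Wilson's theorem). Thus (n - 1)!! ≡ 3^m ≡ -1 (mod 4) when i = 2 and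
-- ≡ 1 (mod 2^i) when i > 2, matching the right-hand sides since m^2 ≡ 1 (mod 8).

open import Defs

module Congruence where

  open import Data.Integer using (ℤ; +_; -_; _+_; _-_; _*_; _^_; 0ℤ; 1ℤ)
  open import Data.Integer.Divisibility.Signed using (divides; ∣ᵤ⇒∣; ∣⇒∣ᵤ)
  open import Data.Integer.Tactic.RingSolver using (solve-∀)
  open import Data.Integer.Properties using (pos-*)
  open import Data.Nat as ℕ using (zero; suc)
  open import Data.Product using (∃-syntax; _,_)
  open import Relation.Binary.Bundles using (Setoid)
  open import Relation.Binary.PropositionalEquality using (_≡_; refl; trans; cong)

  -- _≡_[mod_] unfolds to a divisibility between absolute values, from which Agda cannot
  -- recover a, b and n; wrapped in a record they become inferable.
  infix 4 _≡_⟨mod_⟩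

  record _≡_⟨mod_⟩ (a b n : ℤ) : Set where
    constructor mod⁺
    field mod⁻ : a ≡ b [mod n ]
  open _≡_⟨mod_⟩ public

  module _ {n : ℤ} where

    mod-intro : ∀ {a b} q → a ≡ b + q * n → a ≡ b ⟨mod n ⟩
    mod-intro {b = b} q a≡ =
      mod⁺ (∣⇒∣ᵤ (divides q (trans (cong (λ x → x - b) a≡) (cancel b (q * n)))))
      where
      cancel : ∀ b x → b + x - b ≡ x
      cancel = solve-∀

    mod-elim : ∀ {a b} → a ≡ b ⟨mod n ⟩ → ∃[ q ] a ≡ b + q * n
    mod-elim {a} {b} a≡b with ∣ᵤ⇒∣ (mod⁻ a≡b)
    ... | divides q a-b≡ = q , trans (split a b) (cong (λ x → b + x) a-b≡)
      where
      split : ∀ a b → a ≡ b + (a - b)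
      split = solve-∀

    mod-refl : ∀ {a} → a ≡ a ⟨mod n ⟩
    mod-refl {a} = mod-intro 0ℤ (pad a n)
      where
      pad : ∀ a n → a ≡ a + 0ℤ * n
      pad = solve-∀

    mod-sym : ∀ {a b} → a ≡ b ⟨mod n ⟩ → b ≡ a ⟨mod n ⟩
    mod-sym {b = b} a≡b with mod-elim a≡b
    ... | q , refl = mod-intro (- q) (flip b q n)
      where
      flip : ∀ b q n → b ≡ (b + q * n) + - q * n
      flip = solve-∀

    mod-trans : ∀ {a b c} → a ≡ b ⟨mod n ⟩ → b ≡ c ⟨mod n ⟩ → a ≡ c ⟨mod n ⟩
    mod-trans {c = c} a≡b b≡c with mod-elim a≡b | mod-elim b≡c
    ... | q , refl | r , refl = mod-intro (r + q) (assoc c r q n)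
      where
      assoc : ∀ c r q n → (c + r * n) + q * n ≡ c + (r + q) * n
      assoc = solve-∀

    mod-*-cong : ∀ {a b c d} →
                 a ≡ b ⟨mod n ⟩ → c ≡ d ⟨mod n ⟩ → a * c ≡ b * d ⟨mod n ⟩
    mod-*-cong {b = b} {d = d} a≡b c≡d with mod-elim a≡b | mod-elim c≡d
    ... | q , refl | r , refl = mod-intro (q * d + b * r + q * r * n) (expand b d q r n)
      where
      expand : ∀ b d q r n → (b + q * n) * (d + r * n) ≡ b * d + (q * d + b * r + q * r * n) * n
      expand = solve-∀

    mod-*-congˡ : ∀ a {b c} → b ≡ c ⟨mod n ⟩ → a * b ≡ a * c ⟨mod n ⟩
    mod-*-congˡ a = mod-*-cong (mod-refl {a})

    mod-^-cong : ∀ {a b} → a ≡ b ⟨mod n ⟩ → ∀ t → a ^ t ≡ b ^ t ⟨mod n ⟩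
    mod-^-cong a≡b zero    = mod-refl
    mod-^-cong a≡b (suc t) = mod-*-cong a≡b (mod-^-cong a≡b t)

    mod-neg-cong : ∀ {a b} → a ≡ b ⟨mod n ⟩ → - a ≡ - b ⟨mod n ⟩
    mod-neg-cong {b = b} a≡b with mod-elim a≡b
    ... | q , refl = mod-intro (- q) (negate b q n)
      where
      negate : ∀ b q n → - (b + q * n) ≡ - b + - q * n
      negate = solve-∀

  mod-setoid : ℤ → Setoid _ _
  mod-setoid n = record
    { Carrier = ℤ
    ; _≈_ = λ a b → a ≡ b ⟨mod n ⟩
    ; isEquivalence = record { refl = mod-refl ; sym = mod-sym ; trans = mod-trans }
    }

  mod-self : ∀ {n} → n ≡ 0ℤ ⟨mod n ⟩
  mod-self {n} = mod-intro 1ℤ (unit n)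
    where
    unit : ∀ n → n ≡ 0ℤ + 1ℤ * n
    unit = solve-∀

  mod-reflexive : ∀ {a b n} → a ≡ b → a ≡ b ⟨mod n ⟩
  mod-reflexive refl = mod-refl

  mod-cong-modulus : ∀ {a b n n′} → n ≡ n′ → a ≡ b ⟨mod n ⟩ → a ≡ b ⟨mod n′ ⟩
  mod-cong-modulus refl a≡b = a≡b

  mod-square-≡1 : ∀ {x d} →
                  x ≡ 1ℤ ⟨mod + 2 * d ⟩ → x * x ≡ 1ℤ ⟨mod + 2 * (+ 2 * d) ⟩
  mod-square-≡1 {d = d} x≡1 with mod-elim x≡1
  ... | q , refl = mod-intro (q + q * q * d) (square q d)
    where
    square : ∀ q d → (1ℤ + q * (+ 2 * d)) * (1ℤ + q * (+ 2 * d))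
                     ≡ 1ℤ + (q + q * q * d) * (+ 2 * (+ 2 * d))
    square = solve-∀

  +m^e≡0 : ∀ m e .{{_ : ℕ.NonZero e}} → + (m ℕ.^ e) ≡ 0ℤ ⟨mod + m ⟩
  +m^e≡0 m (suc e) =
    mod-intro (+ (m ℕ.^ e)) (trans (pos-* m (m ℕ.^ e)) (factor (+ m) (+ (m ℕ.^ e))))
    where
    factor : ∀ x y → x * y ≡ 0ℤ + y * x
    factor = solve-∀

module OddProducts where

  open import Data.Integer using (ℤ; +_; -_; _+_; _-_; _*_; _^_; 0ℤ; 1ℤ)
  open import Data.Integer.Properties
    using (pos-+; pos-*; *-identityʳ; *-zeroʳ; ^-distribˡ-+-*; ^-*-assoc; ^-zeroˡ)
  open import Data.Integer.Tactic.RingSolver using (solve-∀)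
  open import Data.Nat as ℕ using (ℕ; zero; suc; s≤s)
  import Data.Nat.Properties as ℕ
  open import Data.Product using (_,_)
  open import Data.Sum using (inj₁; inj₂)
  open import Relation.Binary.PropositionalEquality
    using (_≡_; refl; sym; trans; cong; cong₂; module ≡-Reasoning)
  import Relation.Binary.Reasoning.Setoid as ≈-Reasoning
  open Congruence

  ^-double : ∀ x e → x ^ (2 ℕ.* e) ≡ x ^ e * x ^ e
  ^-double x e = trans (cong (x ^_) (cong (e ℕ.+_) (ℕ.+-identityʳ e))) (^-distribˡ-+-* x e e)

  pos-^ : ∀ m e → + (m ℕ.^ e) ≡ (+ m) ^ e
  pos-^ m zero    = refl
  pos-^ m (suc e) = trans (pos-* m (m ℕ.^ e)) (cong (+ m *_) (pos-^ m e))

  pos-odd : ∀ k → + (2 ℕ.* k ℕ.+ 1) ≡ + 2 * + k + 1ℤ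
  pos-odd k = trans (pos-+ (2 ℕ.* k) 1) (cong (_+ 1ℤ) (pos-* 2 k))

  -1^odd : ∀ k → (- 1ℤ) ^ (2 ℕ.* k ℕ.+ 1) ≡ - 1ℤ
  -1^odd k = trans (^-distribˡ-+-* (- 1ℤ) (2 ℕ.* k) 1)
                   (cong (_* (- 1ℤ) ^ 1) (trans (sym (^-*-assoc (- 1ℤ) 2 k)) (^-zeroˡ k)))

  odd≡1 : ∀ k → + 2 * + k + 1ℤ ≡ 1ℤ ⟨mod + 2 ⟩
  odd≡1 k = mod-intro (+ k) (shift (+ k))
    where
    shift : ∀ x → + 2 * x + 1ℤ ≡ 1ℤ + x * + 2
    shift = solve-∀

  oddProduct : ℕ → ℤ
  oddProduct zero    = 1ℤ
  oddProduct (suc l) = (+ 2 * + l + 1ℤ) * oddProduct l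

  oddProduct-+-mod-4L : ∀ L M → oddProduct (M ℕ.+ L)
                 ≡ oddProduct L * oddProduct M * (1ℤ + + 2 * + L * + M) ⟨mod + 2 * (+ 2 * + L) ⟩
  oddProduct-+-mod-4L L zero    = mod-intro 0ℤ (pad (oddProduct L) (+ L))
    where
    pad : ∀ p ℓ → p ≡ p * 1ℤ * (1ℤ + + 2 * ℓ * 0ℤ) + 0ℤ * (+ 2 * (+ 2 * ℓ))
    pad = solve-∀
  oddProduct-+-mod-4L L (suc M) with mod-elim (oddProduct-+-mod-4L L M)
  ... | q , ih = mod-intro q′ (trans (cong₂ (λ x y → (+ 2 * x + 1ℤ) * y) (pos-+ M L) ih)
                                    (expand (oddProduct L) (oddProduct M) q (+ L) (+ M)))
    where
    q′ = (+ 2 * (+ M + + L) + 1ℤ) * q + oddProduct L * oddProduct M * + M * (+ L - 1ℤ)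
    expand : ∀ p₁ p₂ q ℓ μ →
      (+ 2 * (μ + ℓ) + 1ℤ) * (p₁ * p₂ * (1ℤ + + 2 * ℓ * μ) + q * (+ 2 * (+ 2 * ℓ)))
      ≡ p₁ * ((+ 2 * μ + 1ℤ) * p₂) * (1ℤ + + 2 * ℓ * (1ℤ + μ))
        + ((+ 2 * (μ + ℓ) + 1ℤ) * q + p₁ * p₂ * μ * (ℓ - 1ℤ)) * (+ 2 * (+ 2 * ℓ))
    expand = solve-∀

  oddProduct-+-mod-2L : ∀ L M →
                        oddProduct (M ℕ.+ L) ≡ oddProduct L * oddProduct M ⟨mod + 2 * + L ⟩
  oddProduct-+-mod-2L L M with mod-elim (oddProduct-+-mod-4L L M)
  ... | q , eq = mod-intro (oddProduct L * oddProduct M * + M + + 2 * q)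
                           (trans eq (regroup (oddProduct L * oddProduct M) q (+ L) (+ M)))
    where
    regroup : ∀ p q ℓ μ → p * (1ℤ + + 2 * ℓ * μ) + q * (+ 2 * (+ 2 * ℓ))
                        ≡ p + (p * μ + + 2 * q) * (+ 2 * ℓ)
    regroup = solve-∀

  oddProduct-*≡^ : ∀ A t → oddProduct (A ℕ.* t) ≡ oddProduct A ^ t ⟨mod + 2 * + A ⟩
  oddProduct-*≡^ A zero    = mod-reflexive (cong oddProduct (ℕ.*-zeroʳ A))
  oddProduct-*≡^ A (suc t) = begin
    oddProduct (A ℕ.* suc t)             ≡⟨ cong oddProduct A[1+t]≡At+A ⟩
    oddProduct (A ℕ.* t ℕ.+ A)           ≈⟨ oddProduct-+-mod-2L A (A ℕ.* t) ⟩
    oddProduct A * oddProduct (A ℕ.* t)  ≈⟨ mod-*-congˡ (oddProduct A) (oddProduct-*≡^ A t) ⟩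
    oddProduct A ^ suc t                 ∎
    where
    open ≈-Reasoning (mod-setoid (+ 2 * + A))
    A[1+t]≡At+A : A ℕ.* suc t ≡ A ℕ.* t ℕ.+ A
    A[1+t]≡At+A = trans (ℕ.*-suc A t) (ℕ.+-comm A (A ℕ.* t))

  oddProduct-2^≡1 : ∀ h →
                    oddProduct (2 ℕ.^ (2 ℕ.+ h)) ≡ 1ℤ ⟨mod + 2 * + (2 ℕ.^ (2 ℕ.+ h)) ⟩
  oddProduct-2^≡1 zero    = mod-intro (+ 13) refl
  oddProduct-2^≡1 (suc h) = mod-cong-modulus (cong (λ d → + 2 * d) (sym (pos-* 2 L))) (begin
    oddProduct (2 ℕ.* L)                 ≡⟨ cong (λ l → oddProduct (L ℕ.+ l)) (ℕ.+-identityʳ L) ⟩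
    oddProduct (L ℕ.+ L)                 ≈⟨ oddProduct-+-mod-4L L L ⟩
    p * p * (1ℤ + + 2 * + L * + L)       ≈⟨ mod-intro (p * p * + J) square-of-even ⟩
    p * p                                ≈⟨ mod-square-≡1 {d = + L} (oddProduct-2^≡1 h) ⟩
    1ℤ                                   ∎)
    where
    J = 2 ℕ.^ suc h
    L = 2 ℕ.* J
    p = oddProduct L
    open ≈-Reasoning (mod-setoid (+ 2 * (+ 2 * + L)))
    regroup : ∀ p ℓ j → p * p * (1ℤ + + 2 * ℓ * (+ 2 * j))
                      ≡ p * p + p * p * j * (+ 2 * (+ 2 * ℓ))
    regroup = solve-∀
    square-of-even : p * p * (1ℤ + + 2 * + L * + L) ≡ p * p + p * p * + J * (+ 2 * (+ 2 * + L))
    square-of-even =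
      trans (cong (λ x → p * p * (1ℤ + + 2 * + L * x)) (pos-* 2 J)) (regroup p (+ L) (+ J))

  oddSquare≡1 : ∀ k → (+ 2 * + k + 1ℤ) * (+ 2 * + k + 1ℤ) ≡ 1ℤ ⟨mod + 8 ⟩
  oddSquare≡1 zero    = mod-refl
  oddSquare≡1 (suc k) = mod-trans (mod-intro (+ k + 1ℤ) (step (+ k))) (oddSquare≡1 k)
    where
    step : ∀ x → (+ 2 * (1ℤ + x) + 1ℤ) * (+ 2 * (1ℤ + x) + 1ℤ)
                 ≡ (+ 2 * x + 1ℤ) * (+ 2 * x + 1ℤ) + (x + 1ℤ) * + 8
    step = solve-∀

  oddPower-2^≡1 : ∀ k h →
                  (+ 2 * + k + 1ℤ) ^ (2 ℕ.^ suc h) ≡ 1ℤ ⟨mod + 2 * + (2 ℕ.^ (2 ℕ.+ h)) ⟩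
  oddPower-2^≡1 k zero    = mod-trans (mod-reflexive (cong (x *_) (*-identityʳ x))) (oddSquare≡1 k)
    where x = + 2 * + k + 1ℤ
  oddPower-2^≡1 k (suc h) = mod-cong-modulus (cong (λ d → + 2 * d) (sym (pos-* 2 L))) (begin
    x ^ (2 ℕ.* e)      ≡⟨ ^-double x e ⟩
    x ^ e * x ^ e      ≈⟨ mod-square-≡1 {d = + L} (oddPower-2^≡1 k h) ⟩
    1ℤ                 ∎)
    where
    x = + 2 * + k + 1ℤ
    e = 2 ℕ.^ suc h
    L = 2 ℕ.^ (2 ℕ.+ h)
    open ≈-Reasoning (mod-setoid (+ 2 * (+ 2 * + L)))

  oddProduct-≡0 : ∀ {k L} → k ℕ.< L → oddProduct L ≡ 0ℤ ⟨mod + 2 * + k + 1ℤ ⟩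
  oddProduct-≡0 {k} {suc L} (s≤s k≤L) with ℕ.m≤n⇒m<n∨m≡n k≤L
  ... | inj₁ k<L  = begin
    c * oddProduct L   ≈⟨ mod-*-congˡ c (oddProduct-≡0 k<L) ⟩
    c * 0ℤ             ≡⟨ *-zeroʳ c ⟩
    0ℤ                 ∎
    where
    c = + 2 * + L + 1ℤ
    open ≈-Reasoning (mod-setoid (+ 2 * + k + 1ℤ))
  ... | inj₂ refl = mod-intro (oddProduct k) (factor (+ 2 * + k + 1ℤ) (oddProduct k))
    where
    factor : ∀ c p → c * p ≡ 0ℤ + p * c
    factor = solve-∀

  oddProduct-!! : ∀ L → + ((2 ℕ.* L ℕ.∸ 1) !!) ≡ oddProduct L
  oddProduct-!! zero    = refl
  oddProduct-!! (suc L) = begin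
    + ((2 ℕ.* suc L ℕ.∸ 1) !!)                 ≡⟨ cong (λ n → + (n !!)) (2[1+L]∸1 L) ⟩
    + (suc (2 ℕ.* L) !!)                        ≡⟨ cong +_ (odd!! L) ⟩
    + (suc (2 ℕ.* L) ℕ.* (2 ℕ.* L ℕ.∸ 1) !!)   ≡⟨ pos-* (suc (2 ℕ.* L)) _ ⟩
    + suc (2 ℕ.* L) * + ((2 ℕ.* L ℕ.∸ 1) !!)   ≡⟨ cong₂ _*_ pos-suc[2L] (oddProduct-!! L) ⟩
    (+ 2 * + L + 1ℤ) * oddProduct L             ∎
    where
    open ≡-Reasoning
    pos-suc[2L] : + suc (2 ℕ.* L) ≡ + 2 * + L + 1ℤ
    pos-suc[2L] = trans (cong +_ (ℕ.+-comm 1 (2 ℕ.* L))) (pos-odd L)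
    2[1+L]∸1 : ∀ L → 2 ℕ.* suc L ℕ.∸ 1 ≡ suc (2 ℕ.* L)
    2[1+L]∸1 L = cong (ℕ._∸ 1) (ℕ.*-suc 2 L)
    odd!! : ∀ L → suc (2 ℕ.* L) !! ≡ suc (2 ℕ.* L) ℕ.* (2 ℕ.* L ℕ.∸ 1) !!
    odd!! zero    = refl
    odd!! (suc L) = refl

open import Data.Nat using (ℕ; _+_; _*_; _^_; _∸_; _≥_; _>_)
open import Data.Integer using (+_; -_)
open import Data.Product using (_×_)
open import Relation.Binary.PropositionalEquality using (_≡_)

open import Data.Nat using (zero; suc; _<_; s≤s; z<s)
import Data.Nat.Properties as ℕ
open import Data.Nat.Divisibility using (_∣_; ∣-trans)
open import Data.Nat.Coprimality as Coprimality using (Coprime; coprime-divisor; coprime-+; 1-coprimeTo)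
open import Data.Nat.LCM using (lcm; lcm-least; gcd*lcm)
open import Data.Nat.Tactic.RingSolver using (solve-∀)
open import Data.Integer as ℤ using (0ℤ; 1ℤ)
open import Data.Integer.Properties using (pos-*; *-identityʳ; ^-zeroˡ)
open import Data.Product using (_,_)
open import Relation.Binary.PropositionalEquality using (refl; sym; trans; cong; subst)
import Relation.Binary.Reasoning.Setoid as ≈-Reasoning
open Congruence
open OddProducts

coprime-* : ∀ {m n o} → Coprime m n → Coprime m o → Coprime m (n * o)
coprime-* m⊥n m⊥o (d∣m , d∣no) =
  m⊥o (d∣m , coprime-divisor (λ (e∣d , e∣n) → m⊥n (∣-trans e∣d d∣m , e∣n)) d∣no)

coprime-^ : ∀ {m n} → Coprime m n → ∀ i → Coprime m (n ^ i)
coprime-^ {m} m⊥n zero    = Coprimality.sym (1-coprimeTo m)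
coprime-^     m⊥n (suc i) = coprime-* m⊥n (coprime-^ m⊥n i)

odd-coprime-2 : ∀ k → Coprime (2 * k + 1) 2
odd-coprime-2 zero    = 1-coprimeTo 2
odd-coprime-2 (suc k) = subst (λ m → Coprime m 2) (two+odd k) (coprime-+ (odd-coprime-2 k))
  where
  two+odd : ∀ k → 2 + (2 * k + 1) ≡ 2 * suc k + 1
  two+odd = solve-∀

mod-combine : ∀ {a b x y} → Coprime a b →
              x ≡ y ⟨mod + a ⟩ → x ≡ y ⟨mod + b ⟩ → x ≡ y ⟨mod + (a * b) ⟩
mod-combine {a} {b} a⊥b (mod⁺ a∣) (mod⁺ b∣) = mod⁺ (subst (_∣ _) lcm≡* (lcm-least a∣ b∣))
  where
  lcm≡* : lcm a b ≡ a * b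
  lcm≡* = trans (sym (ℕ.*-identityˡ (lcm a b)))
                (trans (cong (_* lcm a b) (sym (Coprimality.coprime⇒gcd≡1 a⊥b))) (gcd*lcm a b))

!!-mod-from-2-part : ∀ j k {y} →
  oddProduct (2 ^ j * (2 * k + 1)) ≡ y ⟨mod + (2 ^ suc j) ⟩ → y ≡ 0ℤ ⟨mod + (2 * k + 1) ⟩ →
  (+ ((2 ^ suc j * (2 * k + 1) ∸ 1) !!)) ≡ y [mod + (2 ^ suc j * (2 * k + 1)) ]
!!-mod-from-2-part j k 2-part y≡0 =
  mod⁻ (mod-trans (mod-reflexive link) (mod-combine 2^[1+j]⊥m 2-part (mod-trans odd-part (mod-sym y≡0))))
  where
  m = 2 * k + 1
  2^[1+j]⊥m : Coprime (2 ^ suc j) m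
  2^[1+j]⊥m = Coprimality.sym (coprime-^ (odd-coprime-2 k) (suc j))
  link : + ((2 ^ suc j * m ∸ 1) !!) ≡ oddProduct (2 ^ j * m)
  link = trans (cong (λ n → + ((n ∸ 1) !!)) (ℕ.*-assoc 2 (2 ^ j) m)) (oddProduct-!! (2 ^ j * m))
  k<2^j*m : k < 2 ^ j * m
  k<2^j*m = ℕ.<-≤-trans (ℕ.≤-<-trans (ℕ.m≤m+n k (k + 0)) (ℕ.m<m+n (2 * k) z<s))
                        (ℕ.m≤n*m m (2 ^ j) {{ℕ.m^n≢0 2 j}})
  odd-part : oddProduct (2 ^ j * m) ≡ 0ℤ ⟨mod + m ⟩
  odd-part = mod-cong-modulus (sym (pos-odd k)) (oddProduct-≡0 k<2^j*m)

oddProduct[m]≡m : ∀ k →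
  oddProduct (2 ^ 0 * (2 * k + 1)) ≡ + (2 * k + 1) ⟨mod + (2 ^ 1) ⟩
oddProduct[m]≡m k = begin
  oddProduct (1 * m)   ≈⟨ oddProduct-*≡^ 1 m ⟩
  1ℤ ℤ.^ m             ≡⟨ ^-zeroˡ m ⟩
  1ℤ                   ≈⟨ odd≡1 k ⟨
  + 2 ℤ.* + k ℤ.+ 1ℤ   ≡⟨ pos-odd k ⟨
  + m                  ∎
  where
  m = 2 * k + 1
  open ≈-Reasoning (mod-setoid (+ 2))

oddProduct[2m]≡-m² : ∀ k →
  oddProduct (2 ^ 1 * (2 * k + 1)) ≡ - (+ ((2 * k + 1) ^ 2)) ⟨mod + (2 ^ 2) ⟩
oddProduct[2m]≡-m² k = begin
  oddProduct (2 * m)   ≈⟨ oddProduct-*≡^ 2 m ⟩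
  (+ 3) ℤ.^ m          ≈⟨ mod-^-cong 3≡-1 m ⟩
  (- 1ℤ) ℤ.^ m         ≡⟨ -1^odd k ⟩
  - 1ℤ                 ≈⟨ mod-neg-cong (mod-square-≡1 {d = 1ℤ} (odd≡1 k)) ⟨
  - (x ℤ.* x)          ≡⟨ cong -_ m²≡x*x ⟨
  - (+ (m ^ 2))        ∎
  where
  m = 2 * k + 1
  x = + 2 ℤ.* + k ℤ.+ 1ℤ
  open ≈-Reasoning (mod-setoid (+ 4))
  3≡-1 : + 3 ≡ - 1ℤ ⟨mod + 4 ⟩
  3≡-1 = mod-intro 1ℤ refl
  m²≡x*x : + (m ^ 2) ≡ x ℤ.* x
  m²≡x*x = trans (pos-^ m 2)
                 (trans (cong (λ y → y ℤ.* y ℤ.^ 1) (pos-odd k)) (cong (x ℤ.*_) (*-identityʳ x)))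

oddProduct[2^[2+h]m]≡m^2^[1+h] : ∀ k h →
  oddProduct (2 ^ (2 + h) * (2 * k + 1)) ≡ + ((2 * k + 1) ^ (2 ^ suc h)) ⟨mod + (2 ^ (3 + h)) ⟩
oddProduct[2^[2+h]m]≡m^2^[1+h] k h = mod-cong-modulus (sym (pos-* 2 A)) (begin
  oddProduct (A * m)   ≈⟨ oddProduct-*≡^ A m ⟩
  oddProduct A ℤ.^ m   ≈⟨ mod-^-cong (oddProduct-2^≡1 h) m ⟩
  1ℤ ℤ.^ m             ≡⟨ ^-zeroˡ m ⟩
  1ℤ                   ≈⟨ oddPower-2^≡1 k h ⟨
  x ℤ.^ e              ≡⟨ trans (pos-^ m e) (cong (ℤ._^ e) (pos-odd k)) ⟨
  + (m ^ e)            ∎)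
  where
  m = 2 * k + 1
  x = + 2 ℤ.* + k ℤ.+ 1ℤ
  e = 2 ^ suc h
  A = 2 ^ (2 + h)
  open ≈-Reasoning (mod-setoid (+ 2 ℤ.* + A))

theorem6p2 : (i k : ℕ) → i ≥ 1 →
  let n = 2 ^ i * (2 * k + 1) in
    (i ≡ 1 → (+ ((n ∸ 1) !!)) ≡ (+ (2 * k + 1)) [mod (+ n) ])
    × (i ≡ 2 → (+ ((n ∸ 1) !!)) ≡ (- (+ ((2 * k + 1) ^ 2))) [mod (+ n) ])
    × (i > 2 → (+ ((n ∸ 1) !!)) ≡ (+ ((2 * k + 1) ^ (2 ^ (i ∸ 2)))) [mod (+ n) ])
theorem6p2 i k _ =
    (λ { refl → !!-mod-from-2-part 0 k (oddProduct[m]≡m k) mod-self })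
  , (λ { refl → !!-mod-from-2-part 1 k (oddProduct[2m]≡-m² k) (mod-neg-cong (+m^e≡0 m 2)) })
  , λ { (s≤s (s≤s (s≤s {n = h} _))) →
        !!-mod-from-2-part (2 + h) k (oddProduct[2^[2+h]m]≡m^2^[1+h] k h)
          (+m^e≡0 m (2 ^ suc h) {{ℕ.m^n≢0 2 (suc h)}}) }
  where
  m = 2 * k + 1
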